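{- Let $k\geq 2$ and $n\geq 1$ be integers. Then $$(k+1)e^{(k)}_{n}-2ke^{(k)}_{n-1}=(n+k)F_{n+k-1}^{(k)}-k(n+1)F_{n-1}^{(k)}.$$
   Context: For $n\geq 1$ and $k\geq 2$, the $k$-th order Fibonacci cube $\Gamma^{(k)}_n$ is the subgraph of the hypercube $Q_n$ (vertices: binary strings of length $n$, adjacent iff they differ in exactly one coordinate) induced by the binary strings of length $n$ that do not contain $k$ consecutive 1s; $\Gamma^{(k)}_0$ is the one-vertex graph, so $e^{(k)}_0=0$. Let $e^{(k)}_n=|E(\Gamma^{(k)}_n)|$. The $k$-th order Fibonacci numbers are defined by $F_0^{(k)}=\cdots=F_{k-2}^{(k)}=0$, $F_{k-1}^{(k)}=1$, and $F_n^{(k)}=F_{n-1}^{(k)}+\cdots+F_{n-k}^{(k)}$ for $n\geq k$. -}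

module Defs where

open import Data.Bool using (Bool; true; false; _∧_; _∨_; not; if_then_else_)
open import Data.Nat using (ℕ; zero; suc; _+_; _∸_; _≡ᵇ_; _<ᵇ_)
open import Data.List using (List; []; _∷_; map; concatMap; filter; length; take; drop; upTo; head)
open import Data.Bool.ListAction using (and; any)
open import Data.Nat.ListAction using (sum)
open import Data.Maybe using (fromMaybe)
open import Data.Product using (_×_; _,_)
open import Relation.Nullary.Decidable using (Dec; yes; no)
open import Data.Bool.Properties using (T?)

-- Binary strings of length n, as lists of Booleans (true = 1).
allStrings : ℕ → List (List Bool)
allStrings zero    = [] ∷ []
allStrings (suc n) = concatMap (λ w → (false ∷ w) ∷ (true ∷ w) ∷ []) (allStrings n)

containsRun : ℕ → List Bool → Bool
containsRun k w = any (λ i → and (take k (drop i w)) ∧ ((k + i) Data.Nat.≤ᵇ length w)) (upTo (suc (length w)))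

fibVertices : ℕ → ℕ → List (List Bool)
fibVertices k n = filter (λ w → T? (not (containsRun k w))) (allStrings n)

hamming : List Bool → List Bool → ℕ
hamming (a ∷ u) (b ∷ v) = (if (a ∧ not b) ∨ (not a ∧ b) then 1 else 0) + hamming u v
hamming _ _ = 0

-- strict lexicographic order (0 < 1), used to count each unordered edge once
lexLt : List Bool → List Bool → Bool
lexLt (false ∷ u) (true ∷ v)  = true
lexLt (true ∷ u)  (false ∷ v) = false
lexLt (_ ∷ u)     (_ ∷ v)     = lexLt u v
lexLt _ _ = false

fibEdges : ℕ → ℕ → List (List Bool × List Bool)
fibEdges k n =
  filter (λ p → T? (lexLt (Data.Product.proj₁ p) (Data.Product.proj₂ p) ∧ (hamming (Data.Product.proj₁ p) (Data.Product.proj₂ p) ≡ᵇ 1)))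
    (concatMap (λ u → map (λ v → u , v) (fibVertices k n)) (fibVertices k n))

e : ℕ → ℕ → ℕ
e k n = length (fibEdges k n)

-- fibList k n = F_n ∷ F_{n-1} ∷ … ∷ F_0  (k-th order Fibonacci numbers)
fibList : ℕ → ℕ → List ℕ
fibList k zero    = (if 1 Data.Nat.≡ᵇ k then 1 else 0) ∷ []
fibList k (suc n) = next ∷ prev
  where
  prev = fibList k n
  next = if suc n <ᵇ k
           then (if suc (suc n) ≡ᵇ k then 1 else 0)
           else sum (take k prev)

F : ℕ → ℕ → ℕ
F k n = fromMaybe 0 (head (fibList k n))

{-# OPTIONS --safe #-}

-- Read a string from the left, keeping as state the number r ≤ m = k − 1 of 1s that may still
-- follow.  Splitting on the first letter, the numbers V_r(n) of strings admissible from state r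
-- and E_r(n) of edges among them satisfy
--   V_0(n+1) = V_m(n),  V_{r+1}(n+1) = V_m(n) + V_r(n),
--   E_0(n+1) = E_m(n),  E_{r+1}(n+1) = E_m(n) + E_r(n) + V_r(n),
-- the last term counting the edges 0u–1u.  Hence V_m(n) = F_{n+k}, and combining the states gives
-- e_{n+1} + e_{n−k} + k F_n = 2 e_n + F_{n+k}; also F_{n+k+1} + F_n = 2 F_{n+k}.  Modulo these
-- two recurrences, the residual R(n) = lhs − rhs of the identity at n + 1 satisfies
-- R(n+1) = 2 R(n) − R(n−k), where for n < k the term R(n−k), formed from e_0 = 0 and the small
-- Fibonacci values, is 0.  As R(0) = 0, strong induction gives R ≡ 0.
module Submission where

open import Defs

module Counting where

  open import Data.Bool using (Bool; true; false; _∧_; _∨_; not)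
  open import Data.Bool.ListAction using (and; or; any)
  open import Data.Bool.Properties using (T?; ∧-assoc)
  open import Data.List using (List; []; _∷_; _++_; map; concatMap; filter; length; take; drop; upTo; applyUpTo)
  open import Data.List.Properties using (map-cong; take-all)
  open import Data.Nat
  open import Data.Nat.ListAction using (sum)
  open import Data.Nat.Properties
  open import Data.Nat.Tactic.RingSolver using (solve-∀; solve)
  open import Data.Product using (_,_; proj₁; proj₂)
  open import Function using (_∘_)
  open import Relation.Binary.PropositionalEquality
  open ≡-Reasoning

  𝟙 : Bool → ℕ
  𝟙 true  = 1
  𝟙 false = 0

  ∑ : {A : Set} → List A → (A → ℕ) → ℕ
  ∑ []       f = 0
  ∑ (x ∷ xs) f = f x + ∑ xs f

  syntax ∑ xs (λ x → f) = ∑[ x ∈ xs ] f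

  module _ {A : Set} where

    ∑-cong : ∀ (xs : List A) {f g : A → ℕ} → (∀ x → f x ≡ g x) → ∑ xs f ≡ ∑ xs g
    ∑-cong []       f≗g = refl
    ∑-cong (x ∷ xs) f≗g = cong₂ _+_ (f≗g x) (∑-cong xs f≗g)

    ∑-+ : ∀ (xs : List A) (f g : A → ℕ) → ∑[ x ∈ xs ] (f x + g x) ≡ ∑ xs f + ∑ xs g
    ∑-+ []       f g = refl
    ∑-+ (x ∷ xs) f g = begin
      f x + g x + ∑[ y ∈ xs ] (f y + g y) ≡⟨ cong (f x + g x +_) (∑-+ xs f g) ⟩
      f x + g x + (∑ xs f + ∑ xs g)       ≡⟨ interchange (f x) (g x) (∑ xs f) (∑ xs g) ⟩
      f x + ∑ xs f + (g x + ∑ xs g)       ∎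
      where
      interchange : ∀ a b c d → a + b + (c + d) ≡ a + c + (b + d)
      interchange = solve-∀

    *-distribˡ-∑ : ∀ c (xs : List A) (f : A → ℕ) → c * ∑ xs f ≡ ∑[ x ∈ xs ] (c * f x)
    *-distribˡ-∑ c []       f = *-zeroʳ c
    *-distribˡ-∑ c (x ∷ xs) f = trans (*-distribˡ-+ c (f x) (∑ xs f)) (cong (c * f x +_) (*-distribˡ-∑ c xs f))

    ∑-++ : ∀ (xs ys : List A) (f : A → ℕ) → ∑ (xs ++ ys) f ≡ ∑ xs f + ∑ ys f
    ∑-++ []       ys f = refl
    ∑-++ (x ∷ xs) ys f = trans (cong (f x +_) (∑-++ xs ys f)) (sym (+-assoc (f x) _ _))

    ∑-filter : ∀ (p : A → Bool) (xs : List A) (f : A → ℕ) →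
      ∑ (filter (λ x → T? (p x)) xs) f ≡ ∑[ x ∈ xs ] (𝟙 (p x) * f x)
    ∑-filter p []       f = refl
    ∑-filter p (x ∷ xs) f with p x
    ... | true  = cong₂ _+_ (sym (+-identityʳ (f x))) (∑-filter p xs f)
    ... | false = ∑-filter p xs f

    length≡∑1 : ∀ (xs : List A) → length xs ≡ ∑[ _ ∈ xs ] 1
    length≡∑1 []       = refl
    length≡∑1 (x ∷ xs) = cong suc (length≡∑1 xs)

  module _ {A B : Set} where

    ∑-map : ∀ (h : A → B) (xs : List A) (f : B → ℕ) → ∑ (map h xs) f ≡ ∑[ x ∈ xs ] f (h x)
    ∑-map h []       f = refl
    ∑-map h (x ∷ xs) f = cong (f (h x) +_) (∑-map h xs f)

    ∑-concatMap : ∀ (h : A → List B) (xs : List A) (f : B → ℕ) →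
      ∑ (concatMap h xs) f ≡ ∑[ x ∈ xs ] ∑ (h x) f
    ∑-concatMap h []       f = refl
    ∑-concatMap h (x ∷ xs) f = trans (∑-++ (h x) (concatMap h xs) f) (cong (∑ (h x) f +_) (∑-concatMap h xs f))

  ∑-allStrings-suc : ∀ n (f : List Bool → ℕ) →
    ∑ (allStrings (suc n)) f ≡ ∑[ w ∈ allStrings n ] (f (false ∷ w) + f (true ∷ w))
  ∑-allStrings-suc n f =
    trans (∑-concatMap (λ w → (false ∷ w) ∷ (true ∷ w) ∷ []) (allStrings n) f)
          (∑-cong (allStrings n) (λ w → cong (f (false ∷ w) +_) (+-identityʳ (f (true ∷ w)))))

  ∑² : ℕ → (List Bool → List Bool → ℕ) → ℕ
  ∑² n f = ∑[ u ∈ allStrings n ] ∑[ v ∈ allStrings n ] f u v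

  ∑²-cong : ∀ n {f g : List Bool → List Bool → ℕ} → (∀ u v → f u v ≡ g u v) → ∑² n f ≡ ∑² n g
  ∑²-cong n f≗g = ∑-cong (allStrings n) (λ u → ∑-cong (allStrings n) (f≗g u))

  ∑²-+ : ∀ n (f g : List Bool → List Bool → ℕ) → ∑² n (λ u v → f u v + g u v) ≡ ∑² n f + ∑² n g
  ∑²-+ n f g = trans (∑-cong (allStrings n) (λ u → ∑-+ (allStrings n) (f u) (g u)))
                     (∑-+ (allStrings n) (λ u → ∑ (allStrings n) (f u)) (λ u → ∑ (allStrings n) (g u)))

  ∑²-suc : ∀ n (f : List Bool → List Bool → ℕ) →
    ∑² (suc n) f ≡ ∑² n (λ u v → (f (false ∷ u) (false ∷ v) + f (false ∷ u) (true ∷ v))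
                               + (f (true ∷ u) (false ∷ v) + f (true ∷ u) (true ∷ v)))
  ∑²-suc n f = begin
    ∑[ u ∈ allStrings (suc n) ] ∑ (allStrings (suc n)) (f u)
      ≡⟨ ∑-allStrings-suc n _ ⟩
    ∑[ u ∈ A ] (∑ (allStrings (suc n)) (f (false ∷ u)) + ∑ (allStrings (suc n)) (f (true ∷ u)))
      ≡⟨ ∑-cong A (λ u → cong₂ _+_ (∑-allStrings-suc n (f (false ∷ u)))
                                    (∑-allStrings-suc n (f (true ∷ u)))) ⟩
    ∑[ u ∈ A ] (∑[ v ∈ A ] (f (false ∷ u) (false ∷ v) + f (false ∷ u) (true ∷ v))
              + ∑[ v ∈ A ] (f (true ∷ u) (false ∷ v) + f (true ∷ u) (true ∷ v)))
      ≡⟨ ∑-cong A (λ u → sym (∑-+ A _ _)) ⟩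
    ∑² n (λ u v → (f (false ∷ u) (false ∷ v) + f (false ∷ u) (true ∷ v))
                + (f (true ∷ u) (false ∷ v) + f (true ∷ u) (true ∷ v))) ∎
    where A = allStrings n

  ∑²-diagonal : ∀ n (g : List Bool → List Bool → ℕ) →
    ∑² n (λ u v → g u v * 𝟙 (hamming u v ≡ᵇ 0)) ≡ ∑[ u ∈ allStrings n ] g u u
  ∑²-diagonal zero    g = cong (_+ 0) (trans (+-identityʳ _) (*-identityʳ (g [] [])))
  ∑²-diagonal (suc n) g = begin
    ∑² (suc n) (λ u v → g u v * δ u v)
      ≡⟨ ∑²-suc n _ ⟩
    ∑² n (λ u v → (g (false ∷ u) (false ∷ v) * δ u v + g (false ∷ u) (true ∷ v) * 0)
                + (g (true ∷ u) (false ∷ v) * 0 + g (true ∷ u) (true ∷ v) * δ u v))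
      ≡⟨ ∑²-cong n (λ u v → off-diagonal (g (false ∷ u) (false ∷ v)) (g (false ∷ u) (true ∷ v))
                                          (g (true ∷ u) (false ∷ v)) (g (true ∷ u) (true ∷ v)) (δ u v)) ⟩
    ∑² n (λ u v → g (false ∷ u) (false ∷ v) * δ u v + g (true ∷ u) (true ∷ v) * δ u v)
      ≡⟨ ∑²-+ n _ _ ⟩
    ∑² n (λ u v → g (false ∷ u) (false ∷ v) * δ u v) + ∑² n (λ u v → g (true ∷ u) (true ∷ v) * δ u v)
      ≡⟨ cong₂ _+_ (∑²-diagonal n (λ u v → g (false ∷ u) (false ∷ v)))
                   (∑²-diagonal n (λ u v → g (true ∷ u) (true ∷ v))) ⟩
    ∑[ u ∈ allStrings n ] g (false ∷ u) (false ∷ u) + ∑[ u ∈ allStrings n ] g (true ∷ u) (true ∷ u)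
      ≡⟨ sym (∑-+ (allStrings n) _ _) ⟩
    ∑[ u ∈ allStrings n ] (g (false ∷ u) (false ∷ u) + g (true ∷ u) (true ∷ u))
      ≡⟨ sym (∑-allStrings-suc n _) ⟩
    ∑[ u ∈ allStrings (suc n) ] g u u ∎
    where
    δ : List Bool → List Bool → ℕ
    δ u v = 𝟙 (hamming u v ≡ᵇ 0)
    off-diagonal : ∀ a b c d x → a * x + b * 0 + (c * 0 + d * x) ≡ a * x + d * x
    off-diagonal = solve-∀

  -- Runs of 1s

  startsWithOnes : ℕ → List Bool → Bool
  startsWithOnes zero    w       = true
  startsWithOnes (suc j) []      = false
  startsWithOnes (suc j) (x ∷ w) = x ∧ startsWithOnes j w

  startsWithOnes-mono : ∀ {i j} w → i ≤ j → startsWithOnes j w ≡ true → startsWithOnes i w ≡ true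
  startsWithOnes-mono w           z≤n       _ = refl
  startsWithOnes-mono (true ∷ w)  (s≤s i≤j) p = startsWithOnes-mono w i≤j p

  window : ℕ → List Bool → ℕ → Bool
  window k w i = and (take k (drop i w)) ∧ (k + i ≤ᵇ length w)

  m≤ᵇn≡m<ᵇ1+n : ∀ m n → (m ≤ᵇ n) ≡ (m <ᵇ suc n)
  m≤ᵇn≡m<ᵇ1+n zero    n = refl
  m≤ᵇn≡m<ᵇ1+n (suc m) n = refl

  window-zero : ∀ k w → window k w 0 ≡ startsWithOnes k w
  window-zero zero    w       = refl
  window-zero (suc k) []      = refl
  window-zero (suc k) (x ∷ w) = begin
    (x ∧ and (take k w)) ∧ (k + 0 <ᵇ suc (length w))
      ≡⟨ ∧-assoc x _ _ ⟩
    x ∧ (and (take k w) ∧ (k + 0 <ᵇ suc (length w)))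
      ≡⟨ cong (λ b → x ∧ (and (take k w) ∧ b)) (sym (m≤ᵇn≡m<ᵇ1+n (k + 0) (length w))) ⟩
    x ∧ window k w 0
      ≡⟨ cong (x ∧_) (window-zero k w) ⟩
    x ∧ startsWithOnes k w ∎

  window-suc : ∀ k x w i → window k (x ∷ w) (suc i) ≡ window k w i
  window-suc k x w i = cong (and (take k (drop i w)) ∧_) (begin
    k + suc i ≤ᵇ suc (length w)  ≡⟨ cong (_≤ᵇ suc (length w)) (+-suc k i) ⟩
    k + i <ᵇ suc (length w)      ≡⟨ sym (m≤ᵇn≡m<ᵇ1+n (k + i) (length w)) ⟩
    k + i ≤ᵇ length w            ∎)

  any-applyUpTo : ∀ (g : ℕ → Bool) f n → any g (applyUpTo f n) ≡ any (g ∘ f) (upTo n)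
  any-applyUpTo g f zero    = refl
  any-applyUpTo g f (suc n) = cong (g (f 0) ∨_)
    (trans (any-applyUpTo g (f ∘ suc) n) (sym (any-applyUpTo (g ∘ f) suc n)))

  containsRun-∷ : ∀ k x w → containsRun k (x ∷ w) ≡ startsWithOnes k (x ∷ w) ∨ containsRun k w
  containsRun-∷ k x w = cong₂ _∨_ (window-zero k (x ∷ w)) (begin
    any (window k (x ∷ w)) (applyUpTo suc (suc (length w)))
      ≡⟨ any-applyUpTo (window k (x ∷ w)) suc (suc (length w)) ⟩
    any (window k (x ∷ w) ∘ suc) (upTo (suc (length w)))
      ≡⟨ cong or (map-cong (window-suc k x w) (upTo (suc (length w)))) ⟩
    containsRun k w ∎)

  startsWithOnes⇒containsRun : ∀ m w → startsWithOnes (suc m) w ≡ true → containsRun (suc m) w ≡ true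
  startsWithOnes⇒containsRun m (x ∷ w) p = trans (containsRun-∷ (suc m) x w) (cong (_∨ containsRun (suc m) w) p)

  ∨-absorbs : ∀ {b c} → (b ≡ true → c ≡ true) → b ∨ c ≡ c
  ∨-absorbs {true}  b⇒c = sym (b⇒c refl)
  ∨-absorbs {false} b⇒c = refl

  ∨-redundant : ∀ a b c → (b ≡ true → a ≡ true) → a ∨ (b ∨ c) ≡ a ∨ c
  ∨-redundant true  b     c b⇒a = refl
  ∨-redundant false true  c b⇒a with b⇒a refl
  ... | ()
  ∨-redundant false false c b⇒a = refl

  runsWithin : ℕ → ℕ → List Bool → Bool
  runsWithin m r       []          = true
  runsWithin m r       (false ∷ w) = runsWithin m m w
  runsWithin m zero    (true ∷ w)  = false
  runsWithin m (suc r) (true ∷ w)  = runsWithin m r w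

  runsWithin-mono : ∀ {m r s} w → r ≤ s → runsWithin m r w ≡ true → runsWithin m s w ≡ true
  runsWithin-mono []          r≤s       p = refl
  runsWithin-mono (false ∷ w) r≤s       p = p
  runsWithin-mono (true ∷ w)  (s≤s r≤s) p = runsWithin-mono w r≤s p

  runsWithin-spec : ∀ {m r} w → r ≤ m →
    runsWithin m r w ≡ not (startsWithOnes (suc r) w ∨ containsRun (suc m) w)
  runsWithin-spec             []          r≤m = refl
  runsWithin-spec {m}         (false ∷ w) r≤m = begin
    runsWithin m m w
      ≡⟨ runsWithin-spec w ≤-refl ⟩
    not (startsWithOnes (suc m) w ∨ containsRun (suc m) w)
      ≡⟨ cong not (∨-absorbs (startsWithOnes⇒containsRun m w)) ⟩
    not (containsRun (suc m) w)
      ≡⟨ cong not (sym (containsRun-∷ (suc m) false w)) ⟩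
    not (containsRun (suc m) (false ∷ w)) ∎
  runsWithin-spec {r = zero}  (true ∷ w)  r≤m = refl
  runsWithin-spec {m} {suc r} (true ∷ w)  r<m = begin
    runsWithin m r w
      ≡⟨ runsWithin-spec w (<⇒≤ r<m) ⟩
    not (startsWithOnes (suc r) w ∨ containsRun (suc m) w)
      ≡⟨ cong not (sym (∨-redundant _ _ _ (startsWithOnes-mono w r<m))) ⟩
    not (startsWithOnes (suc r) w ∨ (startsWithOnes m w ∨ containsRun (suc m) w))
      ≡⟨ cong (λ b → not (startsWithOnes (suc r) w ∨ b)) (sym (containsRun-∷ (suc m) true w)) ⟩
    not (startsWithOnes (suc r) w ∨ containsRun (suc m) (true ∷ w)) ∎

  runsWithin≡noRun : ∀ m w → runsWithin m m w ≡ not (containsRun (suc m) w)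
  runsWithin≡noRun m w =
    trans (runsWithin-spec w ≤-refl) (cong not (∨-absorbs (startsWithOnes⇒containsRun m w)))

  -- Counting by automaton state

  isEdge : List Bool → List Bool → Bool
  isEdge u v = lexLt u v ∧ (hamming u v ≡ᵇ 1)

  vertexCount : ℕ → ℕ → ℕ → ℕ
  vertexCount m r n = ∑[ w ∈ allStrings n ] 𝟙 (runsWithin m r w)

  edgeIndicator : ℕ → ℕ → List Bool → List Bool → ℕ
  edgeIndicator m r u v = 𝟙 (runsWithin m r u) * (𝟙 (runsWithin m r v) * 𝟙 (isEdge u v))

  edgeCount : ℕ → ℕ → ℕ → ℕ
  edgeCount m r n = ∑² n (edgeIndicator m r)

  e≡edgeCount : ∀ m n → e (suc m) n ≡ edgeCount m m n
  e≡edgeCount m n = begin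
    length (fibEdges (suc m) n)
      ≡⟨ length≡∑1 (fibEdges (suc m) n) ⟩
    ∑[ _ ∈ fibEdges (suc m) n ] 1
      ≡⟨ ∑-filter (λ p → isEdge (proj₁ p) (proj₂ p)) (concatMap (λ u → map (u ,_) V) V) (λ _ → 1) ⟩
    ∑[ p ∈ concatMap (λ u → map (u ,_) V) V ] (𝟙 (isEdge (proj₁ p) (proj₂ p)) * 1)
      ≡⟨ ∑-concatMap (λ u → map (u ,_) V) V _ ⟩
    ∑[ u ∈ V ] ∑ (map (u ,_) V) (λ p → 𝟙 (isEdge (proj₁ p) (proj₂ p)) * 1)
      ≡⟨ ∑-cong V (λ u → ∑-map (u ,_) V _) ⟩
    ∑[ u ∈ V ] ∑[ v ∈ V ] (𝟙 (isEdge u v) * 1)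
      ≡⟨ ∑-filter noRun (allStrings n) _ ⟩
    ∑[ u ∈ allStrings n ] (𝟙 (noRun u) * ∑[ v ∈ V ] (𝟙 (isEdge u v) * 1))
      ≡⟨ ∑-cong (allStrings n) (λ u → cong (𝟙 (noRun u) *_) (∑-filter noRun (allStrings n) _)) ⟩
    ∑[ u ∈ allStrings n ] (𝟙 (noRun u) * ∑[ v ∈ allStrings n ] (𝟙 (noRun v) * (𝟙 (isEdge u v) * 1)))
      ≡⟨ ∑-cong (allStrings n) (λ u → trans (*-distribˡ-∑ (𝟙 (noRun u)) (allStrings n) _)
                                            (∑-cong (allStrings n) (indicator u))) ⟩
    edgeCount m m n ∎
    where
    V = fibVertices (suc m) n
    noRun : List Bool → Bool
    noRun w = not (containsRun (suc m) w)
    indicator : ∀ u v → 𝟙 (noRun u) * (𝟙 (noRun v) * (𝟙 (isEdge u v) * 1)) ≡ edgeIndicator m m u v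
    indicator u v rewrite runsWithin≡noRun m u | runsWithin≡noRun m v | *-identityʳ (𝟙 (isEdge u v)) = refl

  vertexCount-zero-suc : ∀ m n → vertexCount m 0 (suc n) ≡ vertexCount m m n
  vertexCount-zero-suc m n = trans (∑-allStrings-suc n _) (∑-cong (allStrings n) (λ w → +-identityʳ _))

  vertexCount-suc-suc : ∀ m r n → vertexCount m (suc r) (suc n) ≡ vertexCount m m n + vertexCount m r n
  vertexCount-suc-suc m r n = trans (∑-allStrings-suc n _) (∑-+ (allStrings n) _ _)

  edgeCount-zero-suc : ∀ m n → edgeCount m 0 (suc n) ≡ edgeCount m m n
  edgeCount-zero-suc m n =
    trans (∑²-suc n _) (∑²-cong n (λ u v → only-00 (edgeIndicator m m u v) (𝟙 (runsWithin m m u))))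
    where
    only-00 : ∀ a x → a + x * 0 + 0 ≡ a
    only-00 = solve-∀

  -- The edges flipping the first letter join 0u and 1u; 1u is admissible from state r + 1 iff u
  -- is admissible from state r, and then 0u is admissible as well.
  edgeCount-suc-suc : ∀ m r n → suc r ≤ m →
    edgeCount m (suc r) (suc n) ≡ edgeCount m m n + edgeCount m r n + vertexCount m r n
  edgeCount-suc-suc m r n r<m = begin
    edgeCount m (suc r) (suc n)
      ≡⟨ ∑²-suc n _ ⟩
    ∑² n (λ u v → edgeIndicator m m u v + 𝟙 (runsWithin m m u) * (𝟙 (runsWithin m r v) * δ u v)
                + (𝟙 (runsWithin m r u) * (𝟙 (runsWithin m m v) * 0) + edgeIndicator m r u v))
      ≡⟨ ∑²-cong n (λ u v → regroup (edgeIndicator m m u v) (edgeIndicator m r u v)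
                                     (𝟙 (runsWithin m m u)) (𝟙 (runsWithin m r v))
                                     (𝟙 (runsWithin m r u)) (𝟙 (runsWithin m m v)) (δ u v)) ⟩
    ∑² n (λ u v → edgeIndicator m m u v + edgeIndicator m r u v
                + 𝟙 (runsWithin m m u) * 𝟙 (runsWithin m r v) * δ u v)
      ≡⟨ ∑²-+ n _ _ ⟩
    ∑² n (λ u v → edgeIndicator m m u v + edgeIndicator m r u v)
      + ∑² n (λ u v → 𝟙 (runsWithin m m u) * 𝟙 (runsWithin m r v) * δ u v)
      ≡⟨ cong₂ _+_ (∑²-+ n _ _)
                   (∑²-diagonal n (λ u v → 𝟙 (runsWithin m m u) * 𝟙 (runsWithin m r v))) ⟩
    edgeCount m m n + edgeCount m r n + ∑[ u ∈ allStrings n ] (𝟙 (runsWithin m m u) * 𝟙 (runsWithin m r u))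
      ≡⟨ cong (edgeCount m m n + edgeCount m r n +_) (∑-cong (allStrings n) both) ⟩
    edgeCount m m n + edgeCount m r n + vertexCount m r n ∎
    where
    δ : List Bool → List Bool → ℕ
    δ u v = 𝟙 (hamming u v ≡ᵇ 0)
    regroup : ∀ a b x y x′ y′ d → a + x * (y * d) + (x′ * (y′ * 0) + b) ≡ a + b + x * y * d
    regroup = solve-∀
    both : ∀ u → 𝟙 (runsWithin m m u) * 𝟙 (runsWithin m r u) ≡ 𝟙 (runsWithin m r u)
    both u with runsWithin m r u in eq
    ... | false = *-zeroʳ (𝟙 (runsWithin m m u))
    ... | true  rewrite runsWithin-mono u (<⇒≤ r<m) eq = refl

  edgeCount-zero : ∀ m n → edgeCount m 0 n ≡ edgeCount m m (n ∸ 1)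
  edgeCount-zero m zero    = refl
  edgeCount-zero m (suc n) = edgeCount-zero-suc m n

  r*vertexCount-suc : ∀ m r n → r * vertexCount m r (suc n) ≡ r * vertexCount m m n + r * vertexCount m (pred r) n
  r*vertexCount-suc m zero    n = refl
  r*vertexCount-suc m (suc r) n =
    trans (cong (suc r *_) (vertexCount-suc-suc m r n)) (*-distribˡ-+ (suc r) (vertexCount m m n) (vertexCount m r n))

  -- At r = m this yields the edge recurrence; the other states are needed because the
  -- recurrence for E_{r+1} involves E_r.
  edgeCount-difference : ∀ m n r → r ≤ m →
    edgeCount m r (suc n) + edgeCount m m (n ∸ suc r) + vertexCount m m n + r * vertexCount m r n
      ≡ edgeCount m r n + edgeCount m m n + vertexCount m r (suc n) + r * vertexCount m (pred r) n
  edgeCount-difference m n zero r≤m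
    rewrite edgeCount-zero-suc m n | edgeCount-zero m n | vertexCount-zero-suc m n =
    cong (λ x → x + vertexCount m m n + 0) (+-comm (edgeCount m m n) (edgeCount m m (n ∸ 1)))
  edgeCount-difference m zero (suc r) r<m
    rewrite edgeCount-suc-suc m r 0 r<m | vertexCount-suc-suc m r 0 = refl
  edgeCount-difference m (suc n) (suc r) r<m = begin
    E (suc r) (suc (suc n)) + E m (n ∸ suc r) + V m (suc n) + suc r * V (suc r) (suc n)
      ≡⟨ cong₂ (λ x y → x + E m (n ∸ suc r) + V m (suc n) + suc r * y)
               (edgeCount-suc-suc m r (suc n) r<m) (vertexCount-suc-suc m r n) ⟩
    E m (suc n) + E r (suc n) + V r (suc n) + E m (n ∸ suc r) + V m (suc n) + suc r * (V m n + V r n)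
      ≡⟨ rearrange (E m (suc n)) (E r (suc n)) (V r (suc n)) (E m (n ∸ suc r)) (V m (suc n)) (V m n) (V r n)
                   (E m n) (E r n) (V (pred r) n) r
                   (edgeCount-difference m n r (<⇒≤ r<m)) (r*vertexCount-suc m r n) ⟩
    E m n + E r n + V r n + E m (suc n) + (V m (suc n) + V r (suc n)) + suc r * V r (suc n)
      ≡⟨ sym (cong₂ (λ x y → x + E m (suc n) + y + suc r * V r (suc n))
                    (edgeCount-suc-suc m r n r<m) (vertexCount-suc-suc m r (suc n))) ⟩
    E (suc r) (suc n) + E m (suc n) + V (suc r) (suc (suc n)) + suc r * V r (suc n) ∎
    where
    E = edgeCount m
    V = vertexCount m
    rearrange : ∀ Em₁ Er₁ Vr₁ L Vm₁ Vm Vr Em Er Vp r →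
      Er₁ + L + Vm + r * Vr ≡ Er + Em + Vr₁ + r * Vp →
      r * Vr₁ ≡ r * Vm + r * Vp →
      Em₁ + Er₁ + Vr₁ + L + Vm₁ + suc r * (Vm + Vr) ≡ Em + Er + Vr + Em₁ + (Vm₁ + Vr₁) + suc r * Vr₁
    rearrange Em₁ Er₁ Vr₁ L Vm₁ Vm Vr Em Er Vp r ih r*Vr₁ = begin
      Em₁ + Er₁ + Vr₁ + L + Vm₁ + suc r * (Vm + Vr)
        ≡⟨ solve (Em₁ ∷ Er₁ ∷ Vr₁ ∷ L ∷ Vm₁ ∷ Vm ∷ Vr ∷ r ∷ []) ⟩
      (Er₁ + L + Vm + r * Vr) + (Em₁ + Vr₁ + Vm₁ + r * Vm + Vr)
        ≡⟨ cong (_+ (Em₁ + Vr₁ + Vm₁ + r * Vm + Vr)) ih ⟩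
      (Er + Em + Vr₁ + r * Vp) + (Em₁ + Vr₁ + Vm₁ + r * Vm + Vr)
        ≡⟨ solve (Em₁ ∷ Vr₁ ∷ Vm₁ ∷ Vm ∷ Vr ∷ Em ∷ Er ∷ Vp ∷ r ∷ []) ⟩
      Em + Er + Vr + Em₁ + (Vm₁ + Vr₁) + (Vr₁ + (r * Vm + r * Vp))
        ≡⟨ cong (λ x → Em + Er + Vr + Em₁ + (Vm₁ + Vr₁) + (Vr₁ + x)) (sym r*Vr₁) ⟩
      Em + Er + Vr + Em₁ + (Vm₁ + Vr₁) + suc r * Vr₁ ∎

  -- k-th order Fibonacci numbers, k = suc m

  <⇒<ᵇ≡true : ∀ {m n} → m < n → (m <ᵇ n) ≡ true
  <⇒<ᵇ≡true {zero}  (s≤s m<n) = refl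
  <⇒<ᵇ≡true {suc m} (s≤s m<n) = <⇒<ᵇ≡true m<n

  ≥⇒<ᵇ≡false : ∀ {m n} → n ≤ m → (m <ᵇ n) ≡ false
  ≥⇒<ᵇ≡false z≤n       = refl
  ≥⇒<ᵇ≡false (s≤s n≤m) = ≥⇒<ᵇ≡false n≤m

  <⇒≡ᵇ≡false : ∀ {m n} → m < n → (m ≡ᵇ n) ≡ false
  <⇒≡ᵇ≡false {zero}  (s≤s m<n) = refl
  <⇒≡ᵇ≡false {suc m} (s≤s m<n) = <⇒≡ᵇ≡false m<n

  ≡ᵇ-refl : ∀ n → (n ≡ᵇ n) ≡ true
  ≡ᵇ-refl zero    = refl
  ≡ᵇ-refl (suc n) = ≡ᵇ-refl n

  F-below : ∀ {m j} → j < m → F (suc m) j ≡ 0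
  F-below {j = zero}  (s≤s _) = refl
  F-below {j = suc j} j<m     rewrite <⇒<ᵇ≡true (<-trans (n<1+n j) j<m) | <⇒≡ᵇ≡false j<m = refl

  F-at : ∀ m → F (suc m) m ≡ 1
  F-at zero    = refl
  F-at (suc j) rewrite <⇒<ᵇ≡true (n<1+n j) | ≡ᵇ-refl j = refl

  F-suc : ∀ {m j} → m ≤ j → F (suc m) (suc j) ≡ sum (take (suc m) (fibList (suc m) j))
  F-suc m≤j rewrite ≥⇒<ᵇ≡false m≤j = refl

  sum-take-fibList-below : ∀ {m} i j → j < m → sum (take i (fibList (suc m) j)) ≡ 0
  sum-take-fibList-below zero    j       j<m = refl
  sum-take-fibList-below (suc i) zero    j<m = cong₂ _+_ (F-below j<m) (cong sum (take-all i [] z≤n))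
  sum-take-fibList-below (suc i) (suc j) j<m =
    cong₂ _+_ (F-below j<m) (sum-take-fibList-below i j (<-trans (n<1+n j) j<m))

  sum-take-suc-fibList : ∀ k i j → i ≤ j →
    sum (take (suc i) (fibList k j)) ≡ sum (take i (fibList k j)) + F k (j ∸ i)
  sum-take-suc-fibList k zero    zero    _         = +-identityʳ (F k 0)
  sum-take-suc-fibList k zero    (suc j) _         = +-identityʳ (F k (suc j))
  sum-take-suc-fibList k (suc i) (suc j) (s≤s i≤j) =
    trans (cong (F k (suc j) +_) (sum-take-suc-fibList k i j i≤j)) (sym (+-assoc (F k (suc j)) _ _))

  vertexCount≡sum-take-fibList : ∀ m r n → r ≤ m →
    vertexCount m r n ≡ sum (take (suc r) (fibList (suc m) (n + m)))
  vertexCount≡sum-take-fibList zero     zero    zero    _   = refl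
  vertexCount≡sum-take-fibList (suc m)  r       zero    _   =
    sym (cong₂ _+_ (F-at (suc m)) (sum-take-fibList-below r m ≤-refl))
  vertexCount≡sum-take-fibList m        zero    (suc n) _   = begin
    vertexCount m 0 (suc n)                       ≡⟨ vertexCount-zero-suc m n ⟩
    vertexCount m m n                             ≡⟨ vertexCount≡sum-take-fibList m m n ≤-refl ⟩
    sum (take (suc m) (fibList (suc m) (n + m)))  ≡⟨ sym (F-suc (m≤n+m m n)) ⟩
    F (suc m) (suc (n + m))                       ≡⟨ sym (+-identityʳ _) ⟩
    sum (take 1 (fibList (suc m) (suc n + m)))    ∎
  vertexCount≡sum-take-fibList m        (suc r) (suc n) r<m =
    trans (vertexCount-suc-suc m r n)
          (cong₂ _+_ (trans (vertexCount≡sum-take-fibList m m n ≤-refl) (sym (F-suc (m≤n+m m n))))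
                     (vertexCount≡sum-take-fibList m r n (<⇒≤ r<m)))

  vertexCount≡F : ∀ m n → vertexCount m m n ≡ F (suc m) (n + suc m)
  vertexCount≡F m n = begin
    vertexCount m m n                             ≡⟨ vertexCount≡sum-take-fibList m m n ≤-refl ⟩
    sum (take (suc m) (fibList (suc m) (n + m)))  ≡⟨ sym (F-suc (m≤n+m m n)) ⟩
    F (suc m) (suc (n + m))                       ≡⟨ cong (F (suc m)) (sym (+-suc n m)) ⟩
    F (suc m) (n + suc m)                         ∎

  F-at-suc : ∀ m → F (suc m) (suc m) ≡ 1
  F-at-suc m = sym (vertexCount≡F m 0)

  m*vertexCount-split : ∀ m n → m * vertexCount m m n ≡ m * vertexCount m (pred m) n + m * F (suc m) n
  m*vertexCount-split zero    n = refl
  m*vertexCount-split (suc m) n =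
    trans (cong (suc m *_) top≡below+F) (*-distribˡ-+ (suc m) (vertexCount (suc m) m n) (F k n))
    where
    k = suc (suc m)
    top≡below+F : vertexCount (suc m) (suc m) n ≡ vertexCount (suc m) m n + F k n
    top≡below+F = begin
      vertexCount (suc m) (suc m) n
        ≡⟨ vertexCount≡sum-take-fibList (suc m) (suc m) n ≤-refl ⟩
      sum (take (suc (suc m)) (fibList k (n + suc m)))
        ≡⟨ sum-take-suc-fibList k (suc m) (n + suc m) (m≤n+m (suc m) n) ⟩
      sum (take (suc m) (fibList k (n + suc m))) + F k (n + suc m ∸ suc m)
        ≡⟨ cong₂ _+_ (sym (vertexCount≡sum-take-fibList (suc m) m n (n≤1+n m)))
                     (cong (F k) (m+n∸n≡m n (suc m))) ⟩
      vertexCount (suc m) m n + F k n ∎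

  F-recurrence : ∀ m n → F (suc m) (suc (n + suc m)) + F (suc m) n ≡ 2 * F (suc m) (n + suc m)
  F-recurrence m n rewrite +-suc n m = begin
    F k (suc (suc j)) + F k n    ≡⟨ cong (_+ F k n) (F-suc (m≤n+m m (suc n))) ⟩
    F k (suc j) + S + F k n      ≡⟨ +-assoc (F k (suc j)) S (F k n) ⟩
    F k (suc j) + (S + F k n)    ≡⟨ cong (F k (suc j) +_) (sym F[1+j]≡S+F[n]) ⟩
    F k (suc j) + F k (suc j)    ≡⟨ cong (F k (suc j) +_) (sym (+-identityʳ _)) ⟩
    2 * F k (suc j)              ∎
    where
    k = suc m
    j = n + m
    S = sum (take m (fibList k j))
    F[1+j]≡S+F[n] : F k (suc j) ≡ S + F k n
    F[1+j]≡S+F[n] = begin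
      F k (suc j)                  ≡⟨ F-suc (m≤n+m m n) ⟩
      sum (take k (fibList k j))   ≡⟨ sum-take-suc-fibList k m j (m≤n+m m n) ⟩
      S + F k (j ∸ m)              ≡⟨ cong (λ i → S + F k i) (m+n∸n≡m n m) ⟩
      S + F k n                    ∎

  edge-recurrence : ∀ m n → let k = suc m in
    e k (suc n) + e k (n ∸ k) + k * F k n ≡ 2 * e k n + F k (n + k)
  edge-recurrence m n = +-cancelʳ-≡ (A + m * Vp) _ _ (begin
    e k (suc n) + e k (n ∸ k) + k * F k n + (A + m * Vp)
      ≡⟨ cong₂ (λ x y → x + y + k * F k n + (A + m * Vp)) (e≡edgeCount m (suc n)) (e≡edgeCount m (n ∸ k)) ⟩
    E (suc n) + E (n ∸ k) + k * F k n + (A + m * Vp)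
      ≡⟨ regroup₁ (E (suc n)) (E (n ∸ k)) (F k n) A m Vp ⟩
    E (suc n) + E (n ∸ k) + A + (m * Vp + m * F k n) + F k n
      ≡⟨ cong₂ (λ x y → E (suc n) + E (n ∸ k) + x + y + F k n)
               (sym (vertexCount≡F m n)) (sym (m*vertexCount-split m n)) ⟩
    E (suc n) + E (n ∸ k) + vertexCount m m n + m * vertexCount m m n + F k n
      ≡⟨ cong (_+ F k n) (edgeCount-difference m n m ≤-refl) ⟩
    E n + E n + vertexCount m m (suc n) + m * Vp + F k n
      ≡⟨ cong (λ x → E n + E n + x + m * Vp + F k n) (vertexCount≡F m (suc n)) ⟩
    E n + E n + F k (suc (n + k)) + m * Vp + F k n
      ≡⟨ regroup₂ (E n) (F k (suc (n + k))) (F k n) (m * Vp) ⟩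
    E n + E n + (F k (suc (n + k)) + F k n) + m * Vp
      ≡⟨ cong (λ x → E n + E n + x + m * Vp) (F-recurrence m n) ⟩
    E n + E n + 2 * A + m * Vp
      ≡⟨ regroup₃ (E n) A (m * Vp) ⟩
    2 * E n + A + (A + m * Vp)
      ≡⟨ cong (λ x → 2 * x + A + (A + m * Vp)) (sym (e≡edgeCount m n)) ⟩
    2 * e k n + F k (n + k) + (A + m * Vp) ∎)
    where
    k = suc m
    E = edgeCount m m
    A = F k (n + k)
    Vp = vertexCount m (pred m) n
    regroup₁ : ∀ a b c d m v → a + b + suc m * c + (d + m * v) ≡ a + b + d + (m * v + m * c) + c
    regroup₁ = solve-∀
    regroup₂ : ∀ a b c d → a + a + b + d + c ≡ a + a + (b + c) + d
    regroup₂ = solve-∀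
    regroup₃ : ∀ a b c → a + a + 2 * b + c ≡ 2 * a + b + (b + c)
    regroup₃ = solve-∀

module Residual where

  open import Data.Integer using (ℤ; +_; _+_; _-_; _*_; 0ℤ; 1ℤ)
  open import Data.Integer.Properties using (pos-*)
  open import Data.Integer.Tactic.RingSolver using (solve-∀; solve)
  open import Data.List using ([]; _∷_)
  open import Data.Nat as ℕ using (ℕ; zero; suc; _≤_; _<_; _∸_; s≤s; z≤n)
  open import Data.Nat.Induction using (<-rec)
  open import Data.Nat.Properties
    using (m+n∸n≡m; m≤n⇒m∸n≡0; m∸n+n≡m; m≤n⇒m<n∨m≡n; n<1+n; n≤1+n; ≤-trans; ≤-refl; m≤m+n; _≤?_; ≰⇒>)
  open import Data.Sum using (inj₁; inj₂)
  open import Relation.Nullary using (yes; no)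
  open import Relation.Binary.PropositionalEquality
  open ≡-Reasoning
  open Counting using (edge-recurrence; F-recurrence; F-below; F-at; F-at-suc)

  -- lhs − rhs of the identity at position ν, where κ, e₁, e₀, g₁, g₀ stand for k, e_{ν+1}, e_ν,
  -- F_{ν+k}, F_ν.  INLINE lets the ring solver see through it.
  residualAt : ℤ → ℤ → ℤ → ℤ → ℤ → ℤ → ℤ
  residualAt κ ν e₁ e₀ g₁ g₀ =
    ((κ + 1ℤ) * e₁ - + 2 * κ * e₀) - ((1ℤ + ν + κ) * g₁ - κ * (1ℤ + ν + 1ℤ) * g₀)
  {-# INLINE residualAt #-}

  residualAt-two-step : ∀ κ ν e₀ e₁ e₂ x₁ x₀ h h′ g g′ →
    e₁ ≡ + 2 * e₀ + h - x₀ - κ * g →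
    e₂ ≡ + 2 * e₁ + h′ - x₁ - κ * g′ →
    h′ ≡ + 2 * h - g →
    residualAt κ (1ℤ + ν) e₂ e₁ h′ g′
      ≡ + 2 * residualAt κ ν e₁ e₀ h g - residualAt κ (ν - κ) x₁ x₀ g (+ 2 * g - g′)
  residualAt-two-step κ ν e₀ _ _ x₁ x₀ h _ g g′ refl refl refl =
    solve (κ ∷ ν ∷ e₀ ∷ x₁ ∷ x₀ ∷ h ∷ g ∷ g′ ∷ [])

  i+j≡k⇒i≡k-j : ∀ {i j k : ℤ} → i + j ≡ k → i ≡ k - j
  i+j≡k⇒i≡k-j {i} {j} refl = solve (i ∷ j ∷ [])

  i+j+k≡l⇒i≡l-j-k : ∀ {i j k l : ℤ} → i + j + k ≡ l → i ≡ l - j - k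
  i+j+k≡l⇒i≡l-j-k {i} {j} {k} refl = solve (i ∷ j ∷ k ∷ [])

  eℤ : ℕ → ℕ → ℤ
  eℤ m n = + e (suc m) n

  Fℤ : ℕ → ℕ → ℤ
  Fℤ m n = + F (suc m) n

  residual : ℕ → ℕ → ℤ
  residual m n = residualAt (+ suc m) (+ n) (eℤ m (suc n)) (eℤ m n) (Fℤ m (n ℕ.+ suc m)) (Fℤ m n)

  eℤ-recurrence : ∀ m n →
    eℤ m (suc n) ≡ + 2 * eℤ m n + Fℤ m (n ℕ.+ suc m) - eℤ m (n ∸ suc m) - + suc m * Fℤ m n
  eℤ-recurrence m n = i+j+k≡l⇒i≡l-j-k (begin
    eℤ m (suc n) + eℤ m (n ∸ suc m) + + suc m * Fℤ m n
      ≡⟨ cong (λ z → eℤ m (suc n) + eℤ m (n ∸ suc m) + z) (sym (pos-* (suc m) (F (suc m) n))) ⟩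
    + (e (suc m) (suc n) ℕ.+ e (suc m) (n ∸ suc m) ℕ.+ suc m ℕ.* F (suc m) n)
      ≡⟨ cong +_ (edge-recurrence m n) ⟩
    + (2 ℕ.* e (suc m) n ℕ.+ F (suc m) (n ℕ.+ suc m))
      ≡⟨ cong (_+ Fℤ m (n ℕ.+ suc m)) (pos-* 2 (e (suc m) n)) ⟩
    + 2 * eℤ m n + Fℤ m (n ℕ.+ suc m) ∎)

  Fℤ-recurrence : ∀ m n → Fℤ m (suc (n ℕ.+ suc m)) ≡ + 2 * Fℤ m (n ℕ.+ suc m) - Fℤ m n
  Fℤ-recurrence m n =
    i+j≡k⇒i≡k-j (trans (cong +_ (F-recurrence m n)) (pos-* 2 (F (suc m) (n ℕ.+ suc m))))

  -- The residual at position j − k, evaluated with the values the two recurrences assign there: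
  -- e_{j+1−k} and e_{j−k} (truncated, hence e_0 = 0 when j < k) and F_{j−k} := 2 F_j − F_{j+1}.
  virtualResidual : ℕ → ℕ → ℤ
  virtualResidual m j =
    residualAt (+ suc m) (+ j - + suc m) (eℤ m (suc j ∸ suc m)) (eℤ m (j ∸ suc m))
               (Fℤ m j) (+ 2 * Fℤ m j - Fℤ m (suc j))

  residual-step : ∀ m j → residual m (suc j) ≡ + 2 * residual m j - virtualResidual m j
  residual-step m j =
    residualAt-two-step (+ suc m) (+ j) (eℤ m j) (eℤ m (suc j)) (eℤ m (suc (suc j)))
                        (eℤ m (suc j ∸ suc m)) (eℤ m (j ∸ suc m))
                        (Fℤ m (j ℕ.+ suc m)) (Fℤ m (suc (j ℕ.+ suc m))) (Fℤ m j) (Fℤ m (suc j))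
                        (eℤ-recurrence m j) (eℤ-recurrence m (suc j)) (Fℤ-recurrence m j)

  virtualResidual-shift : ∀ m t → virtualResidual m (t ℕ.+ suc m) ≡ residual m t
  virtualResidual-shift m t = begin
    residualAt κ (+ j - κ) (eℤ m (suc j ∸ k)) (eℤ m (j ∸ k)) (Fℤ m j) (+ 2 * Fℤ m j - Fℤ m (suc j))
      ≡⟨ cong₂ (λ a b → residualAt κ (+ j - κ) (eℤ m a) (eℤ m b) (Fℤ m j) (+ 2 * Fℤ m j - Fℤ m (suc j)))
               (m+n∸n≡m (suc t) k) (m+n∸n≡m t k) ⟩
    residualAt κ (+ j - κ) (eℤ m (suc t)) (eℤ m t) (Fℤ m j) (+ 2 * Fℤ m j - Fℤ m (suc j))
      ≡⟨ cong₂ (λ ν g → residualAt κ ν (eℤ m (suc t)) (eℤ m t) (Fℤ m j) g) (shift (+ t) κ) F[t] ⟩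
    residual m t ∎
    where
    k = suc m
    κ = + k
    j = t ℕ.+ k
    shift : ∀ τ κ → τ + κ - κ ≡ τ
    shift = solve-∀
    cancel : ∀ a b → + 2 * a - (+ 2 * a - b) ≡ b
    cancel = solve-∀
    F[t] : + 2 * Fℤ m j - Fℤ m (suc j) ≡ Fℤ m t
    F[t] = trans (cong (λ g → + 2 * Fℤ m j - g) (Fℤ-recurrence m t)) (cancel (Fℤ m j) (Fℤ m t))

  residualAt-below-k : ∀ m j → j ≤ m →
    residualAt (+ suc m) (+ j - + suc m) 0ℤ 0ℤ (Fℤ m j) (+ 2 * Fℤ m j - Fℤ m (suc j)) ≡ 0ℤ
  residualAt-below-k m j j≤m with m≤n⇒m<n∨m≡n j≤m
  ... | inj₂ refl rewrite F-at j | F-at-suc j = j+1≡k (+ j)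
    where
    j+1≡k : ∀ τ → residualAt (1ℤ + τ) (τ - (1ℤ + τ)) 0ℤ 0ℤ 1ℤ (+ 2 * 1ℤ - 1ℤ) ≡ 0ℤ
    j+1≡k = solve-∀
  ... | inj₁ j<m with m≤n⇒m<n∨m≡n j<m
  ...   | inj₂ refl rewrite F-below (n<1+n j) | F-at (suc j) = j+2≡k (+ j)
    where
    j+2≡k : ∀ τ → residualAt (+ 2 + τ) (τ - (+ 2 + τ)) 0ℤ 0ℤ 0ℤ (+ 2 * 0ℤ - 1ℤ) ≡ 0ℤ
    j+2≡k = solve-∀
  ...   | inj₁ 1+j<m rewrite F-below j<m | F-below 1+j<m = j+2<k (+ suc m) (+ j - + suc m)
    where
    j+2<k : ∀ κ ν → residualAt κ ν 0ℤ 0ℤ 0ℤ (+ 2 * 0ℤ - 0ℤ) ≡ 0ℤ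
    j+2<k = solve-∀

  virtualResidual-small : ∀ m j → j ≤ m → virtualResidual m j ≡ 0ℤ
  virtualResidual-small m j j≤m = begin
    residualAt κ (+ j - κ) (eℤ m (suc j ∸ k)) (eℤ m (j ∸ k)) (Fℤ m j) (+ 2 * Fℤ m j - Fℤ m (suc j))
      ≡⟨ cong₂ (λ a b → residualAt κ (+ j - κ) (eℤ m a) (eℤ m b) (Fℤ m j) (+ 2 * Fℤ m j - Fℤ m (suc j)))
               (m≤n⇒m∸n≡0 (s≤s j≤m)) (m≤n⇒m∸n≡0 (≤-trans j≤m (n≤1+n m))) ⟩
    residualAt κ (+ j - κ) 0ℤ 0ℤ (Fℤ m j) (+ 2 * Fℤ m j - Fℤ m (suc j))
      ≡⟨ residualAt-below-k m j j≤m ⟩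
    0ℤ ∎
    where
    k = suc m
    κ = + k

  residual-zero : ∀ m → residual m 0 ≡ 0ℤ
  residual-zero m = begin
    residual m 0
      ≡⟨ cong (λ x → residualAt κ 0ℤ x 0ℤ (Fℤ m k) (Fℤ m 0)) (eℤ-recurrence m 0) ⟩
    residualAt κ 0ℤ (+ 2 * 0ℤ + Fℤ m k - 0ℤ - κ * Fℤ m 0) 0ℤ (Fℤ m k) (Fℤ m 0)
      ≡⟨ cong (λ g → residualAt κ 0ℤ (+ 2 * 0ℤ + g - 0ℤ - κ * Fℤ m 0) 0ℤ g (Fℤ m 0))
              (cong +_ (F-at-suc m)) ⟩
    residualAt κ 0ℤ (+ 2 * 0ℤ + 1ℤ - 0ℤ - κ * Fℤ m 0) 0ℤ 1ℤ (Fℤ m 0)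
      ≡⟨ base m ⟩
    0ℤ ∎
    where
    k = suc m
    κ = + k
    base : ∀ l → residualAt (+ suc l) 0ℤ (+ 2 * 0ℤ + 1ℤ - 0ℤ - + suc l * Fℤ l 0) 0ℤ 1ℤ (Fℤ l 0) ≡ 0ℤ
    base zero    = refl
    base (suc l) rewrite F-below {suc l} {0} (s≤s z≤n) = F₀≡0 (+ suc (suc l))
      where
      F₀≡0 : ∀ κ → residualAt κ 0ℤ (+ 2 * 0ℤ + 1ℤ - 0ℤ - κ * 0ℤ) 0ℤ 1ℤ 0ℤ ≡ 0ℤ
      F₀≡0 = solve-∀

  residual-vanishes : ∀ m n → residual m n ≡ 0ℤ
  residual-vanishes m = <-rec (λ n → residual m n ≡ 0ℤ) vanishes
    where
    vanishes : ∀ n → (∀ {i} → i < n → residual m i ≡ 0ℤ) → residual m n ≡ 0ℤ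
    vanishes zero    _  = residual-zero m
    vanishes (suc j) ih with j ≤? m
    ... | yes j≤m = trans (residual-step m j)
                          (cong₂ (λ a b → + 2 * a - b) (ih ≤-refl) (virtualResidual-small m j j≤m))
    ... | no  j≰m with j ∸ suc m | m∸n+n≡m (≰⇒> j≰m)
    ...   | t | refl = trans (residual-step m (t ℕ.+ suc m))
                             (cong₂ (λ a b → + 2 * a - b) (ih ≤-refl)
                                    (trans (virtualResidual-shift m t) (ih (s≤s (m≤m+n t (suc m))))))

open import Data.Nat using (ℕ; _≤_)
open import Data.Integer using (ℤ; +_; _-_; _*_)
open import Relation.Binary.PropositionalEquality using (_≡_)
open import Data.Nat using (zero; suc)
open import Data.Integer.Properties using (i-j≡0⇒i≡j)
open Residual using (residual-vanishes)

lemma3p4 : (k n : ℕ) → 2 ≤ k → 1 ≤ n →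
    + (k Data.Nat.+ 1) * + e k n - + (2 Data.Nat.* k) * + e k (n Data.Nat.∸ 1)
      ≡ + (n Data.Nat.+ k) * + F k (n Data.Nat.+ k Data.Nat.∸ 1) - + k * + (n Data.Nat.+ 1) * + F k (n Data.Nat.∸ 1)
-- residual m n computes to lhs − rhs at k = suc m and n + 1.  The identity holds for every k ≥ 1;
-- the hypothesis 2 ≤ k only serves to exclude k = 0.
lemma3p4 zero    n       ()  _
lemma3p4 (suc m) zero    _   ()
lemma3p4 (suc m) (suc n) _   _ = i-j≡0⇒i≡j _ _ (residual-vanishes m n)
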